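{- Let $K$ be a finite Eulerian poset with rank function $\rho$, and let $P\in\mathrm{Or}(K)$ be a projection. Then for all $x,y\in\mathrm{Im}(P)$ with $x\leqslant y$, $$\mu_{\mathrm{Im}(P)}(x,y)=\begin{cases}(-1)^{\rho(y)-\rho(x)}, & \text{if } [x,y]\subseteq\mathrm{Im}(P),\\ 0, & \text{otherwise},\end{cases}$$ where $\mathrm{Im}(P)$ carries the order induced from $K$.
   Context: A finite poset $K$ is graded if it has a minimum, a maximum and a rank function $\rho$; it is Eulerian if it is graded and $\mu_K(x,y)=(-1)^{\rho(y)-\rho(x)}$ for all $x\leqslant y$. $\mathrm{Or}(K)$ is the monoid under composition of order preserving regressive ($f(x)\leqslant x$) maps $K\to K$. For $f:K\to K$, $f_y:=\{x:f(x)=y\}$. An idempotent $P\in\mathrm{Or}(K)$ is a projection if for all $x,y\in\mathrm{Im}(P)$ with $x\leqslant y$ the set $[x,y]\cap P_x$ is an interval of $K$. -}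

module Defs where

open import Data.Nat using (ℕ; zero; suc; _∸_)
open import Data.Fin using (Fin)
open import Data.Fin.Properties using (_≟_)
open import Data.Integer using (ℤ; -_; _+_; _^_; 0ℤ; 1ℤ)
open import Data.List using (List; map; filter; foldr; allFin)
open import Data.Product using (Σ; _×_; _,_)
open import Relation.Nullary using (¬_; yes; no)
open import Relation.Nullary.Decidable using (_×-dec_; ¬?)
open import Relation.Unary using (Pred)
open import Relation.Binary.Core using (Rel)
open import Relation.Binary.Definitions using (Decidable)
open import Relation.Binary.Structures using (IsPartialOrder)
open import Relation.Binary.PropositionalEquality using (_≡_)
open import Level using (0ℓ)

record FinPoset (n : ℕ) : Set₁ where
  field
    _≼_ : Rel (Fin n) 0ℓ
    isPartialOrder : IsPartialOrder _≡_ _≼_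
    _≼?_ : Decidable _≼_

  _≺_ : Rel (Fin n) 0ℓ
  x ≺ y = x ≼ y × ¬ (x ≡ y)

  _≺?_ : Decidable _≺_
  x ≺? y = (x ≼? y) ×-dec ¬? (x ≟ y)

  _⋖_ : Rel (Fin n) 0ℓ
  x ⋖ y = x ≺ y × (∀ z → x ≺ z → ¬ (z ≺ y))

  Interval : Fin n → Fin n → Pred (Fin n) 0ℓ
  Interval a b z = a ≼ z × z ≼ b

open FinPoset public

sumℤ : List ℤ → ℤ
sumℤ = foldr _+_ 0ℤ

sgn : ℕ → ℤ
sgn k = (- 1ℤ) ^ k

module _ {n : ℕ} (K : FinPoset n) where
  private
    _≤_ = _≼_ K
    _≤?_ = _≼?_ K
    _<?_ = _≺?_ K

  mobiusFuel : ℕ → (S : Pred (Fin n) 0ℓ) → Relation.Unary.Decidable S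
             → Fin n → Fin n → ℤ
  mobiusFuel zero S S? x y = 0ℤ
  mobiusFuel (suc f) S S? x y with x ≟ y | x ≤? y
  ... | yes _ | _ = 1ℤ
  ... | no _ | yes _ =
    - sumℤ (map (mobiusFuel f S S? x)
               (filter (λ z → S? z ×-dec ((x ≤? z) ×-dec (z <? y))) (allFin n)))
  ... | no _ | no _ = 0ℤ

  -- Fuel n suffices: any chain in a poset with n elements has length < n.
  mobiusSub : (S : Pred (Fin n) 0ℓ) → Relation.Unary.Decidable S
            → Fin n → Fin n → ℤ
  mobiusSub = mobiusFuel n

  mobius : Fin n → Fin n → ℤ
  mobius = mobiusSub (λ _ → Data.Unit.⊤) (λ _ → yes Data.Unit.tt)
    where import Data.Unit

  IsMinimum : Fin n → Set
  IsMinimum b = ∀ x → b ≤ x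

  IsMaximum : Fin n → Set
  IsMaximum t = ∀ x → x ≤ t

  IsRankFunction : Fin n → (Fin n → ℕ) → Set
  IsRankFunction bot ρ = ρ bot ≡ 0 × (∀ x y → _⋖_ K x y → ρ y ≡ suc (ρ x))

  IsGraded : Fin n → Fin n → (Fin n → ℕ) → Set
  IsGraded bot top ρ = IsMinimum bot × IsMaximum top × IsRankFunction bot ρ

  IsEulerian : Fin n → Fin n → (Fin n → ℕ) → Set
  IsEulerian bot top ρ = IsGraded bot top ρ ×
    (∀ x y → x ≤ y → mobius x y ≡ sgn (ρ y ∸ ρ x))

  IsOr : (Fin n → Fin n) → Set
  IsOr f = (∀ x y → x ≤ y → f x ≤ f y) × (∀ x → f x ≤ x)

  InIm : (Fin n → Fin n) → Pred (Fin n) 0ℓ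
  InIm f x = Σ (Fin n) (λ z → f z ≡ x)

  Fibre : (Fin n → Fin n) → Fin n → Pred (Fin n) 0ℓ
  Fibre f y x = f x ≡ y

  IsIntervalOf : Pred (Fin n) 0ℓ → Set
  IsIntervalOf S = Σ (Fin n) λ a → Σ (Fin n) λ b →
    ∀ z → (S z → Interval K a b z) × (Interval K a b z → S z)

  IsProjection : (Fin n → Fin n) → Set
  IsProjection P = IsOr P × (∀ x → P (P x) ≡ P x) ×
    (∀ x y → InIm P x → InIm P y → x ≤ y →
       IsIntervalOf (λ z → Interval K x y z × Fibre P x z))

  -- Im(P) as a decidable subset (for idempotent P, x ∈ Im P iff P x = x)
  FixP : (Fin n → Fin n) → Pred (Fin n) 0ℓ
  FixP P x = P x ≡ x

  FixP? : (P : Fin n → Fin n) → Relation.Unary.Decidable (FixP P)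
  FixP? P x = P x ≟ x

  mobiusIm : (Fin n → Fin n) → Fin n → Fin n → ℤ
  mobiusIm P = mobiusSub (FixP P) (FixP? P)

-- Write S = Im P. For v, y in S let R(v,y) = Σ (-1)^(ρ y - ρ z) over z in [v,y] with P z = v.
-- For w in S and z ≥ w we have w ≤ P z ≤ z, so summing R(v,y) over v in S ∩ [w,y] regroups
-- into Σ_{z ∈ [w,y]} (-1)^(ρ y - ρ z) = (-1)^(ρ y - ρ w) Σ_{z ∈ [w,y]} μ_K(w,z) = δ(w,y),
-- as K is Eulerian. Hence R is a right inverse of the zeta function of S, so R = μ_S. As P is a
-- projection, the fibre of x inside [x,y] is an interval [x,b], whence, again by the Eulerian
-- property, μ_S(x,y) = R(x,y) = (-1)^(ρ y - ρ x) δ(x,b). If [x,y] ⊆ S then b = P b = x.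
-- Otherwise a minimal z in [x,y] \ S lies in the fibre of x: if not, [x,z) = [x,P z] with
-- P z ≠ x would give μ_K(x,z) = 0, impossible in an Eulerian poset. This z ≠ x lies in [x,b],
-- so b ≠ x.

module Submission where

open import Data.Bool using (if_then_else_)
open import Data.Bool.Properties using (T-≡)
open import Data.Fin using (Fin; zero; suc)
open import Data.Fin.Induction using (po-wellFounded; spo-noetherian; Acc; acc)
open import Data.Fin.Properties using (_≟_; any?; suc-injective)
open import Data.Fin.Subset using (Subset; _∈_; ∣_∣; ⊤)
open import Data.Fin.Subset.Properties using (p⊂q⇒∣p∣<∣q∣; ⊆⊤; ∈⊤; ∣⊤∣≡n)
open import Data.Integer using (ℤ; 0ℤ; 1ℤ; -1ℤ; -_; _*_; _^_) renaming (_+_ to _+ℤ_)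
import Data.Integer.Properties as ℤ
open import Algebra.Properties.Semiring.Sum ℤ.+-*-semiring
  using (sum; sum-syntax; sum-cong-≗; ∑-comm; ∑-distrib-+; *-distribˡ-sum; *-distribʳ-sum; sum-replicate-zero)
open import Data.List using (map; filter; tabulate; allFin)
open import Data.Nat using (ℕ; zero; suc; _∸_; _+_) renaming (_*_ to _*ℕ_; _≤_ to _≤ℕ_; _<_ to _<ℕ_)
import Data.Nat.Properties as ℕ
open import Data.Product using (_×_; _,_; proj₁; proj₂; ∃)
open import Data.Unit using (tt)
import Data.Vec as Vec
open import Data.Vec.Properties using (lookup⇒[]=; []=⇒lookup; lookup∘tabulate)
open import Function using (_∘_; flip)
open import Function.Bundles using (Equivalence; _⇔_; mk⇔)
open import Level using (0ℓ)
open import Relation.Binary.PropositionalEquality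
  using (_≡_; _≢_; refl; sym; trans; cong; cong₂; subst; module ≡-Reasoning)
import Relation.Binary.Construct.NonStrictToStrict as ToStrict
open import Relation.Binary.Structures using (IsPartialOrder; IsStrictPartialOrder)
open import Relation.Nullary using (¬_; Dec; yes; no; does; contradiction)
open import Relation.Nullary.Decidable using (_×-dec_; ¬?; decidable-stable; ⌊_⌋; toWitness; fromWitness)
open import Relation.Unary using (Pred; Decidable; U)
open import Relation.Unary.Properties using (U?)

open import Defs

private
  variable
    A B : Set

infixr 10 [_]·_

[_]·_ : Dec A → ℤ → ℤ
[ d ]· v = if does d then v else 0ℤ

[]·-yes : ∀ (d : Dec A) {v} → A → [ d ]· v ≡ v
[]·-yes (yes _) a = refl
[]·-yes (no ¬a) a = contradiction a ¬a

[]·-no : ∀ (d : Dec A) {v} → ¬ A → [ d ]· v ≡ 0ℤ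
[]·-no (yes a) ¬a = contradiction a ¬a
[]·-no (no _)  ¬a = refl

[]·-cong : ∀ (d : Dec A) {u v} → (A → u ≡ v) → [ d ]· u ≡ [ d ]· v
[]·-cong (yes a) u≡v = u≡v a
[]·-cong (no _)  u≡v = refl

[]·-zero : ∀ (d : Dec A) → [ d ]· 0ℤ ≡ 0ℤ
[]·-zero (yes _) = refl
[]·-zero (no _)  = refl

[]·-⇔ : ∀ (d : Dec A) (e : Dec B) → (A → B) → (B → A) → ∀ v → [ d ]· v ≡ [ e ]· v
[]·-⇔ (yes a) e A→B B→A v = sym ([]·-yes e (A→B a))
[]·-⇔ (no ¬a) e A→B B→A v = sym ([]·-no e (¬a ∘ B→A))

[]·-× : ∀ (d : Dec A) (e : Dec B) v → [ d ]· [ e ]· v ≡ [ d ×-dec e ]· v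
[]·-× (yes _) (yes _) v = refl
[]·-× (yes _) (no _)  v = refl
[]·-× (no _)  e       v = refl

[]·-*ˡ : ∀ (d : Dec A) c u → c * [ d ]· u ≡ [ d ]· (c * u)
[]·-*ˡ (yes _) c u = refl
[]·-*ˡ (no _)  c u = ℤ.*-zeroʳ c

[]·-*ʳ : ∀ (d : Dec A) u c → ([ d ]· u) * c ≡ [ d ]· (u * c)
[]·-*ʳ (yes _) u c = refl
[]·-*ʳ (no _)  u c = ℤ.*-zeroˡ c

[]·-sum : ∀ {n} (d : Dec A) (f : Fin n → ℤ) → [ d ]· sum f ≡ ∑[ i < n ] [ d ]· f i
[]·-sum (yes _) f = refl
[]·-sum {n = n} (no _) f = sym (sum-replicate-zero n)

δ : ∀ {n} → Fin n → Fin n → ℤ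
δ a b = [ a ≟ b ]· 1ℤ

sum-δ : ∀ {n} (a : Fin n) (f : Fin n → ℤ) → ∑[ i < n ] [ i ≟ a ]· f i ≡ f a
sum-δ {suc n} zero f = begin
  ∑[ i < suc n ] [ i ≟ zero ]· f i
    ≡⟨ cong (f zero +ℤ_) (sum-cong-≗ (λ i → []·-no (suc i ≟ zero) {f (suc i)} λ ())) ⟩
  f zero +ℤ sum {n} (λ _ → 0ℤ)
    ≡⟨ cong (f zero +ℤ_) (sum-replicate-zero n) ⟩
  f zero +ℤ 0ℤ
    ≡⟨ ℤ.+-identityʳ (f zero) ⟩
  f zero ∎
  where open ≡-Reasoning
sum-δ {suc n} (suc a) f = begin
  ∑[ i < suc n ] [ i ≟ suc a ]· f i
    ≡⟨ cong₂ _+ℤ_ ([]·-no (zero ≟ suc a) {f zero} λ ())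
                  (sum-cong-≗ (λ i → []·-⇔ (suc i ≟ suc a) (i ≟ a) suc-injective (cong suc) (f (suc i)))) ⟩
  0ℤ +ℤ ∑[ i < n ] [ i ≟ a ]· f (suc i)
    ≡⟨ ℤ.+-identityˡ (∑[ i < n ] [ i ≟ a ]· f (suc i)) ⟩
  ∑[ i < n ] [ i ≟ a ]· f (suc i)
    ≡⟨ sum-δ a (f ∘ suc) ⟩
  f (suc a) ∎
  where open ≡-Reasoning

∑-[]·-δʳ : ∀ {n} {Q : Pred (Fin n) 0ℓ} (Q? : Decidable Q) {a} → Q a → (f : Fin n → ℤ) →
           ∑[ i < n ] [ Q? i ]· (f i * δ i a) ≡ f a
∑-[]·-δʳ {n} Q? {a} Qa f = trans (sum-cong-≗ pointwise) (sum-δ a f)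
  where
  pointwise : ∀ i → [ Q? i ]· (f i * δ i a) ≡ [ i ≟ a ]· f i
  pointwise i with i ≟ a
  ... | yes refl = trans ([]·-yes (Q? i) Qa) (ℤ.*-identityʳ (f i))
  ... | no _     = trans (cong ([ Q? i ]·_) (ℤ.*-zeroʳ (f i))) ([]·-zero (Q? i))

∑-[]·-δˡ : ∀ {n} {Q : Pred (Fin n) 0ℓ} (Q? : Decidable Q) {a} → Q a → (f : Fin n → ℤ) →
           ∑[ i < n ] [ Q? i ]· (δ a i * f i) ≡ f a
∑-[]·-δˡ {n} Q? {a} Qa f = trans (sum-cong-≗ pointwise) (sum-δ a f)
  where
  pointwise : ∀ i → [ Q? i ]· (δ a i * f i) ≡ [ i ≟ a ]· f i
  pointwise i with i ≟ a
  ... | yes refl = trans ([]·-yes (Q? i) Qa) (trans (cong (_* f i) ([]·-yes (i ≟ i) refl)) (ℤ.*-identityˡ (f i)))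
  ... | no i≢a   = trans (cong (λ d → [ Q? i ]· (d * f i)) ([]·-no (a ≟ i) (i≢a ∘ sym))) ([]·-zero (Q? i))

*-distribˡ-∑[]· : ∀ {n} {Q : Fin n → Set} (Q? : ∀ i → Dec (Q i)) c (g : Fin n → ℤ) →
                  c * ∑[ i < n ] [ Q? i ]· g i ≡ ∑[ i < n ] [ Q? i ]· (c * g i)
*-distribˡ-∑[]· Q? c g =
  trans (*-distribˡ-sum c (λ i → [ Q? i ]· g i)) (sum-cong-≗ (λ i → []·-*ˡ (Q? i) c (g i)))

*-distribʳ-∑[]· : ∀ {n} {Q : Fin n → Set} (Q? : ∀ i → Dec (Q i)) c (g : Fin n → ℤ) →
                  (∑[ i < n ] [ Q? i ]· g i) * c ≡ ∑[ i < n ] [ Q? i ]· (g i * c)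
*-distribʳ-∑[]· Q? c g =
  trans (*-distribʳ-sum c (λ i → [ Q? i ]· g i)) (sum-cong-≗ (λ i → []·-*ʳ (Q? i) (g i) c))

sumℤ-filter : ∀ {n} {Q : Pred (Fin n) 0ℓ} (Q? : Decidable Q) (g : Fin n → ℤ) →
              sumℤ (map g (filter Q? (allFin n))) ≡ ∑[ i < n ] [ Q? i ]· g i
sumℤ-filter {n} Q? g = go (λ i → i)
  where
  go : ∀ {k} (h : Fin k → Fin n) → sumℤ (map g (filter Q? (tabulate h))) ≡ ∑[ i < k ] [ Q? (h i) ]· g (h i)
  go {zero}  h = refl
  go {suc k} h with Q? (h zero)
  ... | yes _ = cong (g (h zero) +ℤ_) (go (h ∘ suc))
  ... | no _  = trans (go (h ∘ suc)) (sym (ℤ.+-identityˡ _))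

sgn-square : ∀ k → sgn k * sgn k ≡ 1ℤ
sgn-square k = begin
  sgn k * sgn k        ≡⟨ ℤ.^-distribˡ-+-* -1ℤ k k ⟨
  sgn (k + k)          ≡⟨ cong (λ m → sgn (k + m)) (ℕ.+-identityʳ k) ⟨
  sgn (2 *ℕ k)         ≡⟨ ℤ.^-*-assoc -1ℤ 2 k ⟨
  (-1ℤ ^ 2) ^ k        ≡⟨ ℤ.^-zeroˡ k ⟩
  1ℤ                   ∎
  where open ≡-Reasoning

sgn≢0 : ∀ k → sgn k ≢ 0ℤ
sgn≢0 k sgn≡0 with ℤ.i^n≡0⇒i≡0 -1ℤ k sgn≡0
... | ()

sgn-∸-cancel : ∀ {a b c} → a ≤ℕ b → b ≤ℕ c → sgn (c ∸ a) * sgn (b ∸ a) ≡ sgn (c ∸ b)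
sgn-∸-cancel {a} {b} {c} a≤b b≤c = begin
  sgn (c ∸ a) * sgn (b ∸ a)                    ≡⟨ cong (λ m → sgn m * sgn (b ∸ a)) c∸a≡ ⟩
  sgn ((c ∸ b) + (b ∸ a)) * sgn (b ∸ a)        ≡⟨ cong (_* sgn (b ∸ a)) (ℤ.^-distribˡ-+-* -1ℤ (c ∸ b) (b ∸ a)) ⟩
  sgn (c ∸ b) * sgn (b ∸ a) * sgn (b ∸ a)      ≡⟨ ℤ.*-assoc (sgn (c ∸ b)) _ _ ⟩
  sgn (c ∸ b) * (sgn (b ∸ a) * sgn (b ∸ a))    ≡⟨ cong (sgn (c ∸ b) *_) (sgn-square (b ∸ a)) ⟩
  sgn (c ∸ b) * 1ℤ                             ≡⟨ ℤ.*-identityʳ _ ⟩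
  sgn (c ∸ b)                                  ∎
  where
  open ≡-Reasoning
  c∸a≡ : c ∸ a ≡ (c ∸ b) + (b ∸ a)
  c∸a≡ = trans (cong (_∸ a) (sym (ℕ.m∸n+n≡m b≤c))) (ℕ.+-∸-assoc (c ∸ b) a≤b)

sgn-*-δ : ∀ {n} (f : Fin n → ℕ) x y → sgn (f y ∸ f x) * δ x y ≡ δ x y
sgn-*-δ f x y = go (x ≟ y)
  where
  go : (d : Dec (x ≡ y)) → sgn (f y ∸ f x) * [ d ]· 1ℤ ≡ [ d ]· 1ℤ
  go (yes refl) = cong (λ k → sgn k * 1ℤ) (ℕ.n∸n≡0 (f x))
  go (no _)     = ℤ.*-zeroʳ (sgn (f y ∸ f x))

module Mobius {n : ℕ} (K : FinPoset n) where

  open FinPoset K using ()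
    renaming (_≼_ to _≤_; _≼?_ to _≤?_; _≺_ to _<_; _≺?_ to _<?_; isPartialOrder to ≤-isPartialOrder)
  open IsPartialOrder ≤-isPartialOrder public using ()
    renaming (refl to ≤-refl; trans to ≤-trans; antisym to ≤-antisym)

  <-isStrictPartialOrder : IsStrictPartialOrder _≡_ _<_
  <-isStrictPartialOrder = ToStrict.<-isStrictPartialOrder _≡_ _≤_ ≤-isPartialOrder

  open IsStrictPartialOrder <-isStrictPartialOrder public using ()
    renaming (trans to <-trans; irrefl to <-irrefl)

  _∈[_,_]? : ∀ z x y → Dec (Interval K x y z)
  z ∈[ x , y ]? = (x ≤? z) ×-dec (z ≤? y)

  below : Fin n → Subset n
  below y = Vec.tabulate (λ z → ⌊ z <? y ⌋)

  ∈-below⁺ : ∀ {z y} → z < y → z ∈ below y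
  ∈-below⁺ {z} {y} z<y =
    lookup⇒[]= z (below y) (trans (lookup∘tabulate _ z) (Equivalence.to T-≡ (fromWitness z<y)))

  ∈-below⁻ : ∀ {z y} → z ∈ below y → z < y
  ∈-below⁻ {z} {y} z∈ = toWitness (Equivalence.from T-≡ (trans (sym (lookup∘tabulate _ z)) ([]=⇒lookup z∈)))

  height : Fin n → ℕ
  height y = ∣ below y ∣

  height-mono : ∀ {x y} → x < y → height x <ℕ height y
  height-mono {x} x<y = p⊂q⇒∣p∣<∣q∣
    ( (λ w∈ → ∈-below⁺ (<-trans (∈-below⁻ w∈) x<y))
    , x , ∈-below⁺ x<y , (λ x∈ → <-irrefl refl (∈-below⁻ x∈)) )

  height<n : ∀ y → height y <ℕ n
  height<n y = subst (height y <ℕ_) (∣⊤∣≡n n)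
    (p⊂q⇒∣p∣<∣q∣ (⊆⊤ , y , ∈⊤ , (λ y∈ → <-irrefl refl (∈-below⁻ y∈))))

  module Subposet (S : Pred (Fin n) 0ℓ) (S? : Decidable S) where

    μ : Fin n → Fin n → ℤ
    μ = mobiusSub K S S?

    _∈S[_,_]? : ∀ z x y → Dec (S z × Interval K x y z)
    z ∈S[ x , y ]? = S? z ×-dec z ∈[ x , y ]?

    _∈S[_,_⟩? : ∀ z x y → Dec (S z × x ≤ z × z < y)
    z ∈S[ x , y ⟩? = S? z ×-dec ((x ≤? z) ×-dec (z <? y))

    mobiusFuel-diag : ∀ f x → mobiusFuel K (suc f) S S? x x ≡ 1ℤ
    mobiusFuel-diag f x with x ≟ x
    ... | yes _  = refl
    ... | no x≢x = contradiction refl x≢x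

    mobiusFuel-step : ∀ f {x y} → x ≢ y → x ≤ y →
      mobiusFuel K (suc f) S S? x y ≡ - ∑[ z < n ] [ z ∈S[ x , y ⟩? ]· mobiusFuel K f S S? x z
    mobiusFuel-step f {x} {y} x≢y x≤y with x ≟ y | x ≤? y
    ... | yes x≡y | _      = contradiction x≡y x≢y
    ... | no _    | no x≰y = contradiction x≤y x≰y
    ... | no _    | yes _  = cong -_ (sumℤ-filter (λ z → z ∈S[ x , y ⟩?) (mobiusFuel K f S S? x))

    -- Fuel beyond height y does not change the value, and height y < n, so the fuel n of
    -- mobiusSub is enough for the defining recursion to hold.
    mobiusFuel-stable : ∀ f g {x y} → height y <ℕ f → height y <ℕ g →
      mobiusFuel K f S S? x y ≡ mobiusFuel K g S S? x y
    mobiusFuel-stable (suc f) (suc g) {x} {y} hy<f hy<g with x ≟ y | x ≤? y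
    ... | yes _ | _    = refl
    ... | no _  | no _ = refl
    ... | no _  | yes _ = cong -_ (begin
      sumℤ (map (mobiusFuel K f S S? x) (filter (λ z → z ∈S[ x , y ⟩?) (allFin n)))
        ≡⟨ sumℤ-filter (λ z → z ∈S[ x , y ⟩?) (mobiusFuel K f S S? x) ⟩
      ∑[ z < n ] [ z ∈S[ x , y ⟩? ]· mobiusFuel K f S S? x z
        ≡⟨ sum-cong-≗ (λ z → []·-cong (z ∈S[ x , y ⟩?) λ (_ , _ , z<y) →
             mobiusFuel-stable f g (below-fuel z<y hy<f) (below-fuel z<y hy<g)) ⟩
      ∑[ z < n ] [ z ∈S[ x , y ⟩? ]· mobiusFuel K g S S? x z
        ≡⟨ sumℤ-filter (λ z → z ∈S[ x , y ⟩?) (mobiusFuel K g S S? x) ⟨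
      sumℤ (map (mobiusFuel K g S S? x) (filter (λ z → z ∈S[ x , y ⟩?) (allFin n))) ∎)
      where
      open ≡-Reasoning
      below-fuel : ∀ {z h} → z < y → height y <ℕ suc h → height z <ℕ h
      below-fuel z<y hy<sh = ℕ.<-≤-trans (height-mono z<y) (ℕ.≤-pred hy<sh)

    μ≡mobiusFuel : ∀ {x y} → μ x y ≡ mobiusFuel K (suc (height y)) S S? x y
    μ≡mobiusFuel {y = y} = mobiusFuel-stable n (suc (height y)) (height<n y) (ℕ.n<1+n _)

    μ-diag : ∀ x → μ x x ≡ 1ℤ
    μ-diag x = trans μ≡mobiusFuel (mobiusFuel-diag (height x) x)

    μ-step : ∀ {x y} → x ≢ y → x ≤ y → μ x y ≡ - ∑[ z < n ] [ z ∈S[ x , y ⟩? ]· μ x z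
    μ-step {x} {y} x≢y x≤y = begin
      μ x y
        ≡⟨ μ≡mobiusFuel ⟩
      mobiusFuel K (suc (height y)) S S? x y
        ≡⟨ mobiusFuel-step (height y) x≢y x≤y ⟩
      - ∑[ z < n ] [ z ∈S[ x , y ⟩? ]· mobiusFuel K (height y) S S? x z
        ≡⟨ cong -_ (sum-cong-≗ λ z → []·-cong (z ∈S[ x , y ⟩?) λ (_ , _ , z<y) →
             mobiusFuel-stable (height y) n (height-mono z<y) (height<n z)) ⟩
      - ∑[ z < n ] [ z ∈S[ x , y ⟩? ]· μ x z ∎
      where open ≡-Reasoning

    []·-closed≡top+halfOpen : ∀ {x v} → S v → x ≤ v → ∀ w u →
      [ w ∈S[ x , v ]? ]· u ≡ [ w ≟ v ]· u +ℤ [ w ∈S[ x , v ⟩? ]· u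
    []·-closed≡top+halfOpen {x} {v} Sv x≤v w u = split (w ≟ v)
      where
      split : (d : Dec (w ≡ v)) → [ w ∈S[ x , v ]? ]· u ≡ [ d ]· u +ℤ [ w ∈S[ x , v ⟩? ]· u
      split (yes refl) = trans ([]·-yes (w ∈S[ x , v ]?) (Sv , x≤v , ≤-refl))
        (sym (trans (cong (u +ℤ_) ([]·-no (w ∈S[ x , v ⟩?) λ (_ , _ , w<w) → <-irrefl refl w<w))
                    (ℤ.+-identityʳ u)))
      split (no w≢v) = trans
        ([]·-⇔ (w ∈S[ x , v ]?) (w ∈S[ x , v ⟩?)
               (λ (Sw , x≤w , w≤v) → Sw , x≤w , w≤v , w≢v)
               (λ (Sw , x≤w , w≤v , _) → Sw , x≤w , w≤v) u)
        (sym (ℤ.+-identityˡ _))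

    μ-leftInverse : ∀ {x v} → S v → x ≤ v → ∑[ w < n ] [ w ∈S[ x , v ]? ]· μ x w ≡ δ x v
    μ-leftInverse {x} {v} Sv x≤v = begin
      ∑[ w < n ] [ w ∈S[ x , v ]? ]· μ x w
        ≡⟨ sum-cong-≗ (λ w → []·-closed≡top+halfOpen Sv x≤v w (μ x w)) ⟩
      ∑[ w < n ] ([ w ≟ v ]· μ x w +ℤ [ w ∈S[ x , v ⟩? ]· μ x w)
        ≡⟨ ∑-distrib-+ (λ w → [ w ≟ v ]· μ x w) (λ w → [ w ∈S[ x , v ⟩? ]· μ x w) ⟩
      ∑[ w < n ] [ w ≟ v ]· μ x w +ℤ ∑[ w < n ] [ w ∈S[ x , v ⟩? ]· μ x w
        ≡⟨ cong (_+ℤ ∑[ w < n ] [ w ∈S[ x , v ⟩? ]· μ x w) (sum-δ v (μ x)) ⟩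
      μ x v +ℤ ∑[ w < n ] [ w ∈S[ x , v ⟩? ]· μ x w
        ≡⟨ top+halfOpen (x ≟ v) ⟩
      δ x v ∎
      where
      open ≡-Reasoning
      top+halfOpen : (d : Dec (x ≡ v)) → μ x v +ℤ ∑[ w < n ] [ w ∈S[ x , v ⟩? ]· μ x w ≡ [ d ]· 1ℤ
      top+halfOpen (yes refl) = cong₂ _+ℤ_ (μ-diag x)
        (trans (sum-cong-≗ (λ w → []·-no (w ∈S[ x , x ⟩?) {μ x w} λ (_ , x≤w , w<x) →
                                     <-irrefl (≤-antisym (proj₁ w<x) x≤w) w<x))
               (sum-replicate-zero n))
      top+halfOpen (no x≢v) = trans (cong (_+ℤ halfOpen) (μ-step x≢v x≤v)) (ℤ.+-inverseˡ halfOpen)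
        where halfOpen = ∑[ w < n ] [ w ∈S[ x , v ⟩? ]· μ x w

    ∑-interval-comm : ∀ x y (F : Fin n → Fin n → ℤ) →
      ∑[ w < n ] [ w ∈S[ x , y ]? ]· ∑[ v < n ] [ v ∈S[ w , y ]? ]· F w v ≡
      ∑[ v < n ] [ v ∈S[ x , y ]? ]· ∑[ w < n ] [ w ∈S[ x , v ]? ]· F w v
    ∑-interval-comm x y F = begin
      ∑[ w < n ] [ w ∈S[ x , y ]? ]· ∑[ v < n ] [ v ∈S[ w , y ]? ]· F w v
        ≡⟨ sum-cong-≗ (λ w → []·-sum (w ∈S[ x , y ]?) (λ v → [ v ∈S[ w , y ]? ]· F w v)) ⟩
      ∑[ w < n ] ∑[ v < n ] [ w ∈S[ x , y ]? ]· [ v ∈S[ w , y ]? ]· F w v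
        ≡⟨ ∑-comm (λ w v → [ w ∈S[ x , y ]? ]· [ v ∈S[ w , y ]? ]· F w v) ⟩
      ∑[ v < n ] ∑[ w < n ] [ w ∈S[ x , y ]? ]· [ v ∈S[ w , y ]? ]· F w v
        ≡⟨ sum-cong-≗ (λ v → sum-cong-≗ (λ w → swap-conditions w v)) ⟩
      ∑[ v < n ] ∑[ w < n ] [ v ∈S[ x , y ]? ]· [ w ∈S[ x , v ]? ]· F w v
        ≡⟨ sum-cong-≗ (λ v → []·-sum (v ∈S[ x , y ]?) (λ w → [ w ∈S[ x , v ]? ]· F w v)) ⟨
      ∑[ v < n ] [ v ∈S[ x , y ]? ]· ∑[ w < n ] [ w ∈S[ x , v ]? ]· F w v ∎
      where
      open ≡-Reasoning
      swap-conditions : ∀ w v →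
        [ w ∈S[ x , y ]? ]· [ v ∈S[ w , y ]? ]· F w v ≡ [ v ∈S[ x , y ]? ]· [ w ∈S[ x , v ]? ]· F w v
      swap-conditions w v = begin
        [ w ∈S[ x , y ]? ]· [ v ∈S[ w , y ]? ]· F w v
          ≡⟨ []·-× (w ∈S[ x , y ]?) (v ∈S[ w , y ]?) (F w v) ⟩
        [ w ∈S[ x , y ]? ×-dec v ∈S[ w , y ]? ]· F w v
          ≡⟨ []·-⇔ (w ∈S[ x , y ]? ×-dec v ∈S[ w , y ]?) (v ∈S[ x , y ]? ×-dec w ∈S[ x , v ]?)
                   (λ ((Sw , x≤w , _) , (Sv , w≤v , v≤y)) →
                      (Sv , ≤-trans x≤w w≤v , v≤y) , (Sw , x≤w , w≤v))
                   (λ ((Sv , _ , v≤y) , (Sw , x≤w , w≤v)) →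
                      (Sw , x≤w , ≤-trans w≤v v≤y) , (Sv , w≤v , v≤y))
                   (F w v) ⟩
        [ v ∈S[ x , y ]? ×-dec w ∈S[ x , v ]? ]· F w v
          ≡⟨ []·-× (v ∈S[ x , y ]?) (w ∈S[ x , v ]?) (F w v) ⟨
        [ v ∈S[ x , y ]? ]· [ w ∈S[ x , v ]? ]· F w v ∎

    μ-unique : (R : Fin n → Fin n → ℤ) →
      (∀ {w y} → S w → S y → w ≤ y → ∑[ v < n ] [ v ∈S[ w , y ]? ]· R v y ≡ δ w y) →
      ∀ {x y} → S x → S y → x ≤ y → μ x y ≡ R x y
    μ-unique R R-rightInverse {x} {y} Sx Sy x≤y = begin
      μ x y
        ≡⟨ ∑-[]·-δʳ (_∈S[ x , y ]?) (Sy , x≤y , ≤-refl) (μ x) ⟨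
      ∑[ w < n ] [ w ∈S[ x , y ]? ]· (μ x w * δ w y)
        ≡⟨ sum-cong-≗ (λ w → []·-cong (w ∈S[ x , y ]?) λ (Sw , _ , w≤y) →
             cong (μ x w *_) (sym (R-rightInverse Sw Sy w≤y))) ⟩
      ∑[ w < n ] [ w ∈S[ x , y ]? ]· (μ x w * ∑[ v < n ] [ v ∈S[ w , y ]? ]· R v y)
        ≡⟨ sum-cong-≗ (λ w → cong ([ w ∈S[ x , y ]? ]·_)
                                  (*-distribˡ-∑[]· (_∈S[ w , y ]?) (μ x w) (λ v → R v y))) ⟩
      ∑[ w < n ] [ w ∈S[ x , y ]? ]· ∑[ v < n ] [ v ∈S[ w , y ]? ]· (μ x w * R v y)
        ≡⟨ ∑-interval-comm x y (λ w v → μ x w * R v y) ⟩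
      ∑[ v < n ] [ v ∈S[ x , y ]? ]· ∑[ w < n ] [ w ∈S[ x , v ]? ]· (μ x w * R v y)
        ≡⟨ sum-cong-≗ (λ v → cong ([ v ∈S[ x , y ]? ]·_)
                                  (*-distribʳ-∑[]· (_∈S[ x , v ]?) (R v y) (μ x))) ⟨
      ∑[ v < n ] [ v ∈S[ x , y ]? ]· ((∑[ w < n ] [ w ∈S[ x , v ]? ]· μ x w) * R v y)
        ≡⟨ sum-cong-≗ (λ v → []·-cong (v ∈S[ x , y ]?) λ (Sv , x≤v , _) →
             cong (_* R v y) (μ-leftInverse Sv x≤v)) ⟩
      ∑[ v < n ] [ v ∈S[ x , y ]? ]· (δ x v * R v y)
        ≡⟨ ∑-[]·-δˡ (_∈S[ x , y ]?) (Sx , ≤-refl , x≤y) (λ v → R v y) ⟩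
      R x y ∎
      where open ≡-Reasoning

    μ≡0-if-halfOpen-has-max : ∀ {x z c} → x < z → S c → x ≤ c → x ≢ c →
      (∀ {v} → S v → x ≤ v → (v < z → v ≤ c) × (v ≤ c → v < z)) → μ x z ≡ 0ℤ
    μ≡0-if-halfOpen-has-max {x} {z} {c} (x≤z , x≢z) Sc x≤c x≢c halfOpen≡closed = begin
      μ x z                                        ≡⟨ μ-step x≢z x≤z ⟩
      - ∑[ v < n ] [ v ∈S[ x , z ⟩? ]· μ x v       ≡⟨ cong -_ (sum-cong-≗ same-range) ⟩
      - ∑[ v < n ] [ v ∈S[ x , c ]? ]· μ x v       ≡⟨ cong -_ (μ-leftInverse Sc x≤c) ⟩
      - δ x c                                      ≡⟨ cong -_ ([]·-no (x ≟ c) x≢c) ⟩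
      0ℤ                                           ∎
      where
      open ≡-Reasoning
      same-range : ∀ v → [ v ∈S[ x , z ⟩? ]· μ x v ≡ [ v ∈S[ x , c ]? ]· μ x v
      same-range v = []·-⇔ (v ∈S[ x , z ⟩?) (v ∈S[ x , c ]?)
        (λ (Sv , x≤v , v<z) → Sv , x≤v , proj₁ (halfOpen≡closed Sv x≤v) v<z)
        (λ (Sv , x≤v , v≤c) → Sv , x≤v , proj₂ (halfOpen≡closed Sv x≤v) v≤c)
        (μ x v)

module Ranked {n : ℕ} (K : FinPoset n) (ρ : Fin n → ℕ)
              (ρ-cover : ∀ x y → _⋖_ K x y → ρ y ≡ suc (ρ x)) where

  open FinPoset K using () renaming (_≼_ to _≤_; _≺_ to _<_; _≺?_ to _<?_)
  open Mobius K using (≤-refl; ≤-trans; <-isStrictPartialOrder)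

  cover-below : ∀ {x y} → x < y → ∃ λ c → x ≤ c × _⋖_ K c y
  cover-below {x} {y} x<y = go x (spo-noetherian <-isStrictPartialOrder x) ≤-refl x<y
    where
    go : ∀ z → Acc (flip _<_) z → x ≤ z → z < y → ∃ λ c → x ≤ c × _⋖_ K c y
    go z (acc rs) x≤z z<y with any? (λ w → (z <? w) ×-dec (w <? y))
    ... | yes (w , z<w , w<y) = go w (rs z<w) (≤-trans x≤z (proj₁ z<w)) w<y
    ... | no ∄w               = z , x≤z , z<y , λ w z<w w<y → ∄w (w , z<w , w<y)

  ρ-mono : ∀ {x y} → x ≤ y → ρ x ≤ℕ ρ y
  ρ-mono {x} {y} = go y (po-wellFounded (FinPoset.isPartialOrder K) y)
    where
    go : ∀ y → Acc _<_ y → x ≤ y → ρ x ≤ℕ ρ y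
    go y (acc rs) x≤y with x ≟ y
    ... | yes refl = ℕ.≤-refl
    ... | no x≢y with cover-below (x≤y , x≢y)
    ...   | c , x≤c , c⋖y = ℕ.≤-trans (go c (rs (proj₁ c⋖y)) x≤c)
                                      (subst (ρ c ≤ℕ_) (sym (ρ-cover c y c⋖y)) (ℕ.n≤1+n (ρ c)))

module Eulerian {n : ℕ} (K : FinPoset n) {bot top : Fin n} {ρ : Fin n → ℕ} (eulerian : IsEulerian K bot top ρ) where

  open FinPoset K using () renaming (_≼_ to _≤_)
  open Mobius K using (≤-trans; _∈[_,_]?; module Subposet)
  open Subposet U U? using (μ-leftInverse)
  open Ranked K ρ (proj₂ (proj₂ (proj₂ (proj₁ eulerian)))) public using (ρ-mono)

  mobius≡sgn : ∀ {x y} → x ≤ y → mobius K x y ≡ sgn (ρ y ∸ ρ x)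
  mobius≡sgn = proj₂ eulerian _ _

  mobius≢0 : ∀ {x y} → x ≤ y → mobius K x y ≢ 0ℤ
  mobius≢0 {x} {y} x≤y = sgn≢0 (ρ y ∸ ρ x) ∘ trans (sym (mobius≡sgn x≤y))

  ∑-sgn-interval : ∀ {w c y} → w ≤ c → c ≤ y →
    ∑[ z < n ] [ z ∈[ w , c ]? ]· sgn (ρ y ∸ ρ z) ≡ sgn (ρ y ∸ ρ w) * δ w c
  ∑-sgn-interval {w} {c} {y} w≤c c≤y = begin
    ∑[ z < n ] [ z ∈[ w , c ]? ]· sgn (ρ y ∸ ρ z)
      ≡⟨ sum-cong-≗ (λ z → []·-cong (z ∈[ w , c ]?) λ (w≤z , z≤c) →
                             sgn-via-mobius w≤z (≤-trans z≤c c≤y)) ⟩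
    ∑[ z < n ] [ z ∈[ w , c ]? ]· (sgn (ρ y ∸ ρ w) * mobius K w z)
      ≡⟨ *-distribˡ-∑[]· (_∈[ w , c ]?) (sgn (ρ y ∸ ρ w)) (mobius K w) ⟨
    sgn (ρ y ∸ ρ w) * ∑[ z < n ] [ z ∈[ w , c ]? ]· mobius K w z
      ≡⟨ cong (sgn (ρ y ∸ ρ w) *_) (μ-leftInverse tt w≤c) ⟩
    sgn (ρ y ∸ ρ w) * δ w c ∎
    where
    open ≡-Reasoning
    sgn-via-mobius : ∀ {z} → w ≤ z → z ≤ y → sgn (ρ y ∸ ρ z) ≡ sgn (ρ y ∸ ρ w) * mobius K w z
    sgn-via-mobius {z} w≤z z≤y = begin
      sgn (ρ y ∸ ρ z)                     ≡⟨ sgn-∸-cancel (ρ-mono w≤z) (ρ-mono z≤y) ⟨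
      sgn (ρ y ∸ ρ w) * sgn (ρ z ∸ ρ w)   ≡⟨ cong (sgn (ρ y ∸ ρ w) *_) (mobius≡sgn w≤z) ⟨
      sgn (ρ y ∸ ρ w) * mobius K w z      ∎

module Projection {n : ℕ} (K : FinPoset n) {bot top : Fin n} {ρ : Fin n → ℕ} (eulerian : IsEulerian K bot top ρ)
                  (P : Fin n → Fin n) (P-isOr : IsOr K P) where

  open FinPoset K using () renaming (_≼_ to _≤_; _≼?_ to _≤?_; _≺_ to _<_; _≺?_ to _<?_)
  open Mobius K using (≤-refl; ≤-trans; ≤-antisym; _∈[_,_]?; module Subposet)
  open Subposet U U? using (μ≡0-if-halfOpen-has-max)
  open Subposet (FixP K P) (FixP? K P) using (_∈S[_,_]?)
  open Eulerian K eulerian using (mobius≢0; ∑-sgn-interval)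

  P-mono : ∀ {x y} → x ≤ y → P x ≤ P y
  P-mono = proj₁ P-isOr _ _

  P-regressive : ∀ x → P x ≤ x
  P-regressive = proj₂ P-isOr

  minimal-nonfixed-in-fibre : ∀ {x z} → P x ≡ x → x ≤ z → P z ≢ z →
    (∀ {v} → x ≤ v → v < z → P v ≡ v) → P z ≡ x
  minimal-nonfixed-in-fibre {x} {z} Px≡x x≤z Pz≢z fixed-below with P z ≟ x
  ... | yes Pz≡x = Pz≡x
  ... | no Pz≢x  =
    contradiction (μ≡0-if-halfOpen-has-max x<z tt x≤Pz (Pz≢x ∘ sym) [x,z⟩≡[x,Pz]) (mobius≢0 x≤z)
    where
    x≤Pz : x ≤ P z
    x≤Pz = subst (_≤ P z) Px≡x (P-mono x≤z)
    x<z : x < z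
    x<z = x≤z , λ x≡z → Pz≢z (subst (λ v → P v ≡ v) x≡z Px≡x)
    [x,z⟩≡[x,Pz] : ∀ {v} → U v → x ≤ v → (v < z → v ≤ P z) × (v ≤ P z → v < z)
    [x,z⟩≡[x,Pz] {v} _ x≤v =
        (λ v<z → subst (_≤ P z) (fixed-below x≤v v<z) (P-mono (proj₁ v<z)))
      , (λ v≤Pz → ≤-trans v≤Pz (P-regressive z)
                , λ v≡z → Pz≢z (≤-antisym (P-regressive z) (subst (_≤ P z) v≡z v≤Pz)))

  nontrivial-fibre-element : ∀ {x z} → P x ≡ x → x ≤ z → P z ≢ z →
    ∃ λ z′ → Interval K x z z′ × P z′ ≡ x × z′ ≢ x
  nontrivial-fibre-element {x} {z} Px≡x = go z (po-wellFounded (FinPoset.isPartialOrder K) z)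
    where
    go : ∀ z → Acc _<_ z → x ≤ z → P z ≢ z → ∃ λ z′ → Interval K x z z′ × P z′ ≡ x × z′ ≢ x
    go z (acc rs) x≤z Pz≢z with any? (λ v → (x ≤? v) ×-dec ((v <? z) ×-dec ¬? (P v ≟ v)))
    ... | yes (v , x≤v , v<z , Pv≢v) =
      let z′ , (x≤z′ , z′≤v) , rest = go v (rs v<z) x≤v Pv≢v
      in  z′ , (x≤z′ , ≤-trans z′≤v (proj₁ v<z)) , rest
    ... | no ∄v = z , (x≤z , ≤-refl) , Pz≡x , λ z≡x → Pz≢z (trans Pz≡x (sym z≡x))
      where
      Pz≡x : P z ≡ x
      Pz≡x = minimal-nonfixed-in-fibre Px≡x x≤z Pz≢z λ {v} x≤v v<z →
        decidable-stable (P v ≟ v) λ Pv≢v → ∄v (v , x≤v , v<z , Pv≢v)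

  fibreSum : Fin n → Fin n → ℤ
  fibreSum v y = ∑[ z < n ] [ z ∈[ v , y ]? ×-dec P z ≟ v ]· sgn (ρ y ∸ ρ z)

  fibreSum-rightInverse : (∀ x → P (P x) ≡ P x) → ∀ {w y} → P w ≡ w → w ≤ y →
    ∑[ v < n ] [ v ∈S[ w , y ]? ]· fibreSum v y ≡ δ w y
  fibreSum-rightInverse P-idem {w} {y} Pw≡w w≤y = begin
    ∑[ v < n ] [ v ∈S[ w , y ]? ]· ∑[ z < n ] [ z ∈[ v , y ]? ×-dec P z ≟ v ]· s z
      ≡⟨ sum-cong-≗ (λ v → []·-sum (v ∈S[ w , y ]?) (λ z → [ z ∈[ v , y ]? ×-dec P z ≟ v ]· s z)) ⟩
    ∑[ v < n ] ∑[ z < n ] [ v ∈S[ w , y ]? ]· [ z ∈[ v , y ]? ×-dec P z ≟ v ]· s z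
      ≡⟨ ∑-comm (λ v z → [ v ∈S[ w , y ]? ]· [ z ∈[ v , y ]? ×-dec P z ≟ v ]· s z) ⟩
    ∑[ z < n ] ∑[ v < n ] [ v ∈S[ w , y ]? ]· [ z ∈[ v , y ]? ×-dec P z ≟ v ]· s z
      ≡⟨ sum-cong-≗ (λ z → sum-cong-≗ (only-Pz z)) ⟩
    ∑[ z < n ] ∑[ v < n ] [ v ≟ P z ]· [ z ∈[ w , y ]? ]· s z
      ≡⟨ sum-cong-≗ (λ z → sum-δ (P z) (λ _ → [ z ∈[ w , y ]? ]· s z)) ⟩
    ∑[ z < n ] [ z ∈[ w , y ]? ]· s z
      ≡⟨ ∑-sgn-interval w≤y ≤-refl ⟩
    sgn (ρ y ∸ ρ w) * δ w y
      ≡⟨ sgn-*-δ ρ w y ⟩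
    δ w y ∎
    where
    open ≡-Reasoning
    s : Fin n → ℤ
    s z = sgn (ρ y ∸ ρ z)
    only-Pz : ∀ z v →
      [ v ∈S[ w , y ]? ]· [ z ∈[ v , y ]? ×-dec P z ≟ v ]· s z ≡ [ v ≟ P z ]· [ z ∈[ w , y ]? ]· s z
    only-Pz z v = begin
      [ v ∈S[ w , y ]? ]· [ z ∈[ v , y ]? ×-dec P z ≟ v ]· s z
        ≡⟨ []·-× (v ∈S[ w , y ]?) (z ∈[ v , y ]? ×-dec P z ≟ v) (s z) ⟩
      [ v ∈S[ w , y ]? ×-dec (z ∈[ v , y ]? ×-dec P z ≟ v) ]· s z
        ≡⟨ []·-⇔ (v ∈S[ w , y ]? ×-dec (z ∈[ v , y ]? ×-dec P z ≟ v)) (v ≟ P z ×-dec z ∈[ w , y ]?)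
             (λ ((_ , w≤v , _) , (v≤z , z≤y) , Pz≡v) → sym Pz≡v , ≤-trans w≤v v≤z , z≤y)
             (λ { (refl , w≤z , z≤y) →
                    (P-idem z , subst (_≤ P z) Pw≡w (P-mono w≤z) , ≤-trans (P-regressive z) z≤y)
                  , (P-regressive z , z≤y) , refl })
             (s z) ⟩
      [ v ≟ P z ×-dec z ∈[ w , y ]? ]· s z
        ≡⟨ []·-× (v ≟ P z) (z ∈[ w , y ]?) (s z) ⟨
      [ v ≟ P z ]· [ z ∈[ w , y ]? ]· s z ∎

  FibreInterval : Fin n → Fin n → Fin n → Set
  FibreInterval x y b = ∀ z → (Interval K x y z × P z ≡ x) ⇔ Interval K x b z

  fibreInterval : ∀ {x y} → P x ≡ x → x ≤ y →
    IsIntervalOf K (λ z → Interval K x y z × Fibre K P x z) → ∃ (FibreInterval x y)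
  fibreInterval {x} {y} Px≡x x≤y (a , b , fibre≡[a,b]) = b , λ z → mk⇔
    (λ z∈fibre → let a≤z , z≤b = proj₁ (fibre≡[a,b] z) z∈fibre in subst (_≤ z) a≡x a≤z , z≤b)
    (λ (x≤z , z≤b) → proj₂ (fibre≡[a,b] z) (subst (_≤ z) (sym a≡x) x≤z , z≤b))
    where
    a≤x : a ≤ x
    a≤x = proj₁ (proj₁ (fibre≡[a,b] x) ((≤-refl , x≤y) , Px≡x))
    x≤b : x ≤ b
    x≤b = proj₂ (proj₁ (fibre≡[a,b] x) ((≤-refl , x≤y) , Px≡x))
    a≡x : a ≡ x
    a≡x = ≤-antisym a≤x (proj₁ (proj₁ (proj₂ (fibre≡[a,b] a) (≤-refl , ≤-trans a≤x x≤b))))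

  module TopOfFibre {x y b} (Px≡x : P x ≡ x) (x≤y : x ≤ y) (fibre≡[x,b] : FibreInterval x y b) where

    private
      x≤b : x ≤ b
      x≤b = proj₂ (Equivalence.to (fibre≡[x,b] x) ((≤-refl , x≤y) , Px≡x))

      b∈fibre : Interval K x y b × P b ≡ x
      b∈fibre = Equivalence.from (fibre≡[x,b] b) (x≤b , ≤-refl)

    fibreSum≡sgn*δ : fibreSum x y ≡ sgn (ρ y ∸ ρ x) * δ x b
    fibreSum≡sgn*δ = trans
      (sum-cong-≗ λ z → []·-⇔ (z ∈[ x , y ]? ×-dec P z ≟ x) (z ∈[ x , b ]?)
                              (Equivalence.to (fibre≡[x,b] z)) (Equivalence.from (fibre≡[x,b] z)) _)
      (∑-sgn-interval x≤b (proj₂ (proj₁ b∈fibre)))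

    fibre-trivial : (∀ z → Interval K x y z → P z ≡ z) → x ≡ b
    fibre-trivial all-fixed = trans (sym (proj₂ b∈fibre)) (all-fixed b (proj₁ b∈fibre))

    fibre-nontrivial : ¬ (∀ z → Interval K x y z → P z ≡ z) → x ≢ b
    fibre-nontrivial not-all-fixed x≡b with any? (λ z → z ∈[ x , y ]? ×-dec ¬? (P z ≟ z))
    ... | no ∄z = not-all-fixed λ z z∈[x,y] → decidable-stable (P z ≟ z) λ Pz≢z → ∄z (z , z∈[x,y] , Pz≢z)
    ... | yes (z , (x≤z , z≤y) , Pz≢z) =
      let z′ , (x≤z′ , z′≤z) , Pz′≡x , z′≢x = nontrivial-fibre-element Px≡x x≤z Pz≢z
          z′≤b = proj₂ (Equivalence.to (fibre≡[x,b] z′) ((x≤z′ , ≤-trans z′≤z z≤y) , Pz′≡x))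
      in  z′≢x (≤-antisym (subst (z′ ≤_) (sym x≡b) z′≤b) x≤z′)

proposition3p8 : (n : ℕ) (K : FinPoset n) (bot top : Fin n) (ρ : Fin n → ℕ)
    → IsEulerian K bot top ρ
    → (P : Fin n → Fin n) → IsProjection K P
    → (x y : Fin n) → InIm K P x → InIm K P y → _≼_ K x y
    → ((∀ z → Interval K x y z → InIm K P z) → mobiusIm K P x y ≡ sgn (ρ y ∸ ρ x))
      × (¬ (∀ z → Interval K x y z → InIm K P z) → mobiusIm K P x y ≡ 0ℤ)
proposition3p8 n K bot top ρ eulerian P (P-isOr , P-idem , P-intervals) x y x∈Im y∈Im x≤y =
  full , nonfull
  where
  open Projection K eulerian P P-isOr
  open Mobius.Subposet K (FixP K P) (FixP? K P) using (μ-unique)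

  fixed : ∀ {z} → InIm K P z → P z ≡ z
  fixed (w , refl) = P-idem w

  fibreTop : ∃ (FibreInterval x y)
  fibreTop = fibreInterval (fixed x∈Im) x≤y (P-intervals x y x∈Im y∈Im x≤y)

  b : Fin n
  b = proj₁ fibreTop

  open TopOfFibre (fixed x∈Im) x≤y (proj₂ fibreTop)

  μIm≡sgn*δ : mobiusIm K P x y ≡ sgn (ρ y ∸ ρ x) * δ x b
  μIm≡sgn*δ = trans
    (μ-unique fibreSum (λ Pw≡w _ → fibreSum-rightInverse P-idem Pw≡w) (fixed x∈Im) (fixed y∈Im) x≤y)
    fibreSum≡sgn*δ

  full : (∀ z → Interval K x y z → InIm K P z) → mobiusIm K P x y ≡ sgn (ρ y ∸ ρ x)
  full ⊆Im = begin
    mobiusIm K P x y         ≡⟨ μIm≡sgn*δ ⟩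
    sgn (ρ y ∸ ρ x) * δ x b  ≡⟨ cong (sgn (ρ y ∸ ρ x) *_) ([]·-yes (x ≟ b) x≡b) ⟩
    sgn (ρ y ∸ ρ x) * 1ℤ     ≡⟨ ℤ.*-identityʳ (sgn (ρ y ∸ ρ x)) ⟩
    sgn (ρ y ∸ ρ x)          ∎
    where
    open ≡-Reasoning
    x≡b : x ≡ b
    x≡b = fibre-trivial λ z z∈[x,y] → fixed (⊆Im z z∈[x,y])

  nonfull : ¬ (∀ z → Interval K x y z → InIm K P z) → mobiusIm K P x y ≡ 0ℤ
  nonfull ⊈Im = begin
    mobiusIm K P x y         ≡⟨ μIm≡sgn*δ ⟩
    sgn (ρ y ∸ ρ x) * δ x b  ≡⟨ cong (sgn (ρ y ∸ ρ x) *_) ([]·-no (x ≟ b) x≢b) ⟩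
    sgn (ρ y ∸ ρ x) * 0ℤ     ≡⟨ ℤ.*-zeroʳ (sgn (ρ y ∸ ρ x)) ⟩
    0ℤ                       ∎
    where
    open ≡-Reasoning
    x≢b : x ≢ b
    x≢b = fibre-nontrivial λ all-fixed → ⊈Im λ z z∈[x,y] → z , all-fixed z z∈[x,y]
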